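{- Let $x$ be a modified ascent sequence of length $n$. For every index $i$ with $x(i)=k>1$, the entry $x(i)$ is the leftmost occurrence of the integer $k$ in $x$ if and only if $x(i-1)<x(i)$. In particular, $x$ is a Cayley permutation.
   Context: A Cayley permutation is a word of positive integers in which every integer from $1$ to its maximum occurs. Modified ascent sequences: the empty word and the word $1$ are modified ascent sequences; for $n\ge2$, a word $x$ of length $n$ is one iff either $x=va$ with $v$ a modified ascent sequence of length $n-1$ whose last letter is $b$ and $1\le a\le b$, or $x=\tilde va$ with $v$ as before and $b<a\le 2+\mathrm{asc}(v)$, where $\mathrm{asc}(v)$ is the number of indices $i$ with $v(i)<v(i+1)$ and $\tilde v$ is obtained from $v$ by increasing every entry $c\ge a$ by one. -}

module Defs where

open import Data.Nat using (ℕ; zero; suc; _+_; _≤_; _<_; _≥_)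
open import Data.Nat.Properties using (_<?_; _≤?_)
open import Data.List using (List; []; _∷_; _++_; [_]; length; map; lookup; last)
open import Data.List.Membership.Propositional using (_∈_)
open import Data.Maybe using (Maybe; just)
open import Data.Fin using (Fin; toℕ)
open import Relation.Nullary using (yes; no)
open import Relation.Binary.PropositionalEquality using (_≡_; _≢_)
open import Data.Product using (_×_)
import Data.Nat

ascStep : ℕ → ℕ → ℕ
ascStep x y with x <? y
... | yes _ = 1
... | no _ = 0

asc : List ℕ → ℕ
asc [] = 0
asc (x ∷ []) = 0
asc (x ∷ y ∷ v) = ascStep x y + asc (y ∷ v)

bump : ℕ → List ℕ → List ℕ
bump a = map (λ c → f c)
  where
  f : ℕ → ℕ
  f c with a ≤? c
  ... | yes _ = suc c
  ... | no _ = c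

data MAS : List ℕ → Set where
  mas-empty : MAS []
  mas-one   : MAS [ 1 ]
  mas-weak  : ∀ {v b a} → MAS v → last v ≡ just b →
              1 ≤ a → a ≤ b → MAS (v ++ [ a ])
  mas-asc   : ∀ {v b a} → MAS v → last v ≡ just b →
              b < a → a ≤ 2 + asc v → MAS (bump a v ++ [ a ])

maxL : List ℕ → ℕ
maxL [] = 0
maxL (x ∷ v) = x Data.Nat.⊔ maxL v

IsCayley : List ℕ → Set
IsCayley x = (∀ {c} → c ∈ x → 1 ≤ c) × (∀ k → 1 ≤ k → k ≤ maxL x → k ∈ x)

IsLeftmost : (x : List ℕ) → Fin (length x) → Set
IsLeftmost x i = ∀ (j : Fin (length x)) → toℕ j < toℕ i → lookup x j ≢ lookup x i

module Submission where

-- Induction along the recursive definition, carrying along that the values of x are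
-- exactly 1, …, 1 + asc x.  Appending a ≤ b creates no ascent and repeats a value, as
-- a ≤ b ≤ 1 + asc v already occurs.  In the other step the relabelling c ↦ c + [a ≤ c] is
-- strictly monotone, so it preserves ascents, first occurrences and asc, and it misses the
-- value a; the appended a is thus a new value on an ascent, which raises asc by one.

open import Defs
open import Data.Nat using (ℕ; zero; suc; _<_; _≤_; _+_; z≤n; s≤s)
open import Data.Nat.Properties
open import Data.List using (List; []; _∷_; _++_; [_]; length; lookup; map; last)
open import Data.List.Properties using (length-++; length-map; last-map)
open import Data.List.Relation.Unary.Any using (here; there)
open import Data.List.Membership.Propositional using (_∈_)
open import Data.List.Membership.Propositional.Properties using (∈-map⁺; ∈-map⁻; ∈-++⁺ˡ; ∈-++⁺ʳ; ∈-++⁻)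
open import Data.Maybe using (just)
import Data.Maybe as Maybe
open import Data.Fin using (Fin; toℕ; fromℕ<)
open import Data.Fin.Properties using (toℕ<n; toℕ-fromℕ<)
open import Data.Product using (_×_; _,_; ∃; proj₁; proj₂)
open import Data.Sum using (inj₁; inj₂)
open import Data.Empty using (⊥-elim)
open import Function.Base using (_∘_)
open import Function.Bundles using (_⇔_; mk⇔; Equivalence)
open import Function.Properties.Equivalence using () renaming (trans to ⇔-trans)
open import Relation.Binary.Core using (_Preserves_⟶_)
open import Relation.Binary.Definitions using (tri<; tri≈; tri>)
open import Relation.Nullary using (yes; no; ¬_)
open import Relation.Binary.PropositionalEquality using (_≡_; _≢_; refl; sym; trans; cong; cong₂; subst; subst₂; module ≡-Reasoning)
open ≡-Reasoning

open Equivalence using (to; from)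

-- Positions are 0-based; out of range the value is the junk 0.
infixl 5 _!_
_!_ : List ℕ → ℕ → ℕ
[]      ! _     = 0
(c ∷ x) ! zero  = c
(c ∷ x) ! suc k = x ! k

lookup≡! : ∀ (x : List ℕ) i → lookup x i ≡ x ! toℕ i
lookup≡! (c ∷ x) Fin.zero    = refl
lookup≡! (c ∷ x) (Fin.suc i) = lookup≡! x i

!-++ˡ : ∀ (v w : List ℕ) {k} → k < length v → (v ++ w) ! k ≡ v ! k
!-++ˡ (c ∷ v) w {zero}  _         = refl
!-++ˡ (c ∷ v) w {suc k} (s≤s k<v) = !-++ˡ v w k<v

!-∷ʳ-length : ∀ (v : List ℕ) a → (v ++ [ a ]) ! length v ≡ a
!-∷ʳ-length []      a = refl
!-∷ʳ-length (c ∷ v) a = !-∷ʳ-length v a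

!-map : ∀ (g : ℕ → ℕ) (v : List ℕ) {k} → k < length v → map g v ! k ≡ g (v ! k)
!-map g (c ∷ v) {zero}  _         = refl
!-map g (c ∷ v) {suc k} (s≤s k<v) = !-map g v k<v

!-last : ∀ (v : List ℕ) {b j} → last v ≡ just b → suc j ≡ length v → v ! j ≡ b
!-last (c ∷ [])    {j = zero}  refl refl = refl
!-last (c ∷ d ∷ v) {j = suc j} lastv j<v = !-last (d ∷ v) lastv (suc-injective j<v)

∈⇒index : ∀ {v : List ℕ} {c} → c ∈ v → ∃ λ k → k < length v × v ! k ≡ c
∈⇒index (here refl) = 0 , s≤s z≤n , refl
∈⇒index (there c∈v) with ∈⇒index c∈v
... | k , k<v , vk≡c = suc k , s≤s k<v , vk≡c

last-∈ : ∀ (v : List ℕ) {b} → last v ≡ just b → b ∈ v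
last-∈ (c ∷ [])    refl  = here refl
last-∈ (c ∷ d ∷ v) lastv = there (last-∈ (d ∷ v) lastv)

last-∷ : ∀ (c : ℕ) v → ∃ λ b → last (c ∷ v) ≡ just b
last-∷ c []      = c , refl
last-∷ c (d ∷ v) = last-∷ d v

length-∷ʳ : ∀ (v : List ℕ) a → length (v ++ [ a ]) ≡ suc (length v)
length-∷ʳ v a = trans (length-++ v) (+-comm (length v) 1)

module _ {g : ℕ → ℕ} (g-mono : g Preserves _<_ ⟶ _<_) where

  strictMono-reflects-< : ∀ {p q} → g p < g q → p < q
  strictMono-reflects-< {p} {q} gp<gq with <-cmp p q
  ... | tri< p<q _ _ = p<q
  ... | tri≈ _ refl _ = ⊥-elim (<-irrefl refl gp<gq)
  ... | tri> _ _ q<p = ⊥-elim (<-asym gp<gq (g-mono q<p))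

  strictMono-injective : ∀ {p q} → g p ≡ g q → p ≡ q
  strictMono-injective {p} {q} gp≡gq with <-cmp p q
  ... | tri< p<q _ _ = ⊥-elim (<-irrefl gp≡gq (g-mono p<q))
  ... | tri≈ _ p≡q _ = p≡q
  ... | tri> _ _ q<p = ⊥-elim (<-irrefl (sym gp≡gq) (g-mono q<p))

  ascStep-strictMono : ∀ c d → ascStep (g c) (g d) ≡ ascStep c d
  ascStep-strictMono c d with c <? d | g c <? g d
  ... | yes _   | yes _   = refl
  ... | no _    | no _    = refl
  ... | yes c<d | no gc≮gd = ⊥-elim (gc≮gd (g-mono c<d))
  ... | no c≮d  | yes gc<gd = ⊥-elim (c≮d (strictMono-reflects-< gc<gd))

  asc-map : ∀ v → asc (map g v) ≡ asc v
  asc-map []          = refl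
  asc-map (c ∷ [])    = refl
  asc-map (c ∷ d ∷ v) = cong₂ _+_ (ascStep-strictMono c d) (asc-map (d ∷ v))

ascStep-< : ∀ {c d} → c < d → ascStep c d ≡ 1
ascStep-< {c} {d} c<d with c <? d
... | yes _   = refl
... | no c≮d = ⊥-elim (c≮d c<d)

ascStep-≥ : ∀ {c d} → d ≤ c → ascStep c d ≡ 0
ascStep-≥ {c} {d} d≤c with c <? d
... | yes c<d = ⊥-elim (<-irrefl refl (<-≤-trans c<d d≤c))
... | no _    = refl

asc-∷ʳ : ∀ (v : List ℕ) {b} a → last v ≡ just b → asc (v ++ [ a ]) ≡ asc v + ascStep b a
asc-∷ʳ (c ∷ [])    a refl  = +-identityʳ _
asc-∷ʳ (c ∷ d ∷ v) a lastv = trans (cong (ascStep c d +_) (asc-∷ʳ (d ∷ v) a lastv))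
                                   (sym (+-assoc (ascStep c d) _ _))

bumpFrom : ℕ → ℕ → ℕ
bumpFrom a c with a ≤? c
... | yes _ = suc c
... | no _  = c

bump≡map-bumpFrom : ∀ a v → bump a v ≡ map (bumpFrom a) v
bump≡map-bumpFrom a []      = refl
bump≡map-bumpFrom a (c ∷ v) with a ≤? c
... | yes _ = cong (suc c ∷_) (bump≡map-bumpFrom a v)
... | no _  = cong (c ∷_) (bump≡map-bumpFrom a v)

bumpFrom-< : ∀ {a c} → c < a → bumpFrom a c ≡ c
bumpFrom-< {a} {c} c<a with a ≤? c
... | yes a≤c = ⊥-elim (<-irrefl refl (<-≤-trans c<a a≤c))
... | no _    = refl

bumpFrom-≥ : ∀ {a c} → a ≤ c → bumpFrom a c ≡ suc c
bumpFrom-≥ {a} {c} a≤c with a ≤? c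
... | yes _   = refl
... | no a≰c = ⊥-elim (a≰c a≤c)

bumpFrom-bounds : ∀ a c → c ≤ bumpFrom a c × bumpFrom a c ≤ suc c
bumpFrom-bounds a c with a ≤? c
... | yes _ = n≤1+n c , ≤-refl
... | no _  = ≤-refl , n≤1+n c

bumpFrom-≢ : ∀ a c → bumpFrom a c ≢ a
bumpFrom-≢ a c with a ≤? c
... | yes a≤c = λ 1+c≡a → <-irrefl refl (subst (_≤ c) (sym 1+c≡a) a≤c)
... | no a≰c  = λ c≡a → a≰c (subst (_≤ c) c≡a ≤-refl)

bumpFrom-strictMono : ∀ a → bumpFrom a Preserves _<_ ⟶ _<_
bumpFrom-strictMono a {c} {d} c<d with a ≤? c | a ≤? d
... | yes _   | yes _   = s≤s c<d
... | yes a≤c | no a≰d  = ⊥-elim (a≰d (≤-trans a≤c (<⇒≤ c<d)))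
... | no _    | yes _   = ≤-trans c<d (n≤1+n d)
... | no _    | no _    = c<d

ValuesAre1To : List ℕ → ℕ → Set
ValuesAre1To x m = ∀ c → c ∈ x ⇔ (1 ≤ c × c ≤ m)

valuesAre1To-∷ʳ : ∀ {v m a} → ValuesAre1To v m → 1 ≤ a → a ≤ m → ValuesAre1To (v ++ [ a ]) m
valuesAre1To-∷ʳ {v} {m} {a} values 1≤a a≤m c = mk⇔ bounded occurs
  where
  bounded : c ∈ v ++ [ a ] → 1 ≤ c × c ≤ m
  bounded c∈ with ∈-++⁻ v c∈
  ... | inj₁ c∈v         = to (values c) c∈v
  ... | inj₂ (here refl) = 1≤a , a≤m
  occurs : 1 ≤ c × c ≤ m → c ∈ v ++ [ a ]
  occurs c∈[1,m] = ∈-++⁺ˡ (from (values c) c∈[1,m])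

valuesAre1To-bump : ∀ {v m a} → ValuesAre1To v m → 1 ≤ a → a ≤ suc m →
                    ValuesAre1To (map (bumpFrom a) v ++ [ a ]) (suc m)
valuesAre1To-bump {v} {m} {a} values 1≤a a≤1+m c = mk⇔ bounded occurs
  where
  bounded : c ∈ map (bumpFrom a) v ++ [ a ] → 1 ≤ c × c ≤ suc m
  bounded c∈ with ∈-++⁻ (map (bumpFrom a) v) c∈
  ... | inj₂ (here refl) = 1≤a , a≤1+m
  ... | inj₁ c∈w with ∈-map⁻ (bumpFrom a) c∈w
  ...   | d , d∈v , refl with to (values d) d∈v | bumpFrom-bounds a d
  ...     | 1≤d , d≤m | d≤c , c≤1+d = ≤-trans 1≤d d≤c , ≤-trans c≤1+d (s≤s d≤m)
  occurs : 1 ≤ c × c ≤ suc m → c ∈ map (bumpFrom a) v ++ [ a ]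
  occurs (1≤c , c≤1+m) with <-cmp c a
  ... | tri≈ _ refl _ = ∈-++⁺ʳ _ (here refl)
  ... | tri< c<a _ _  = ∈-++⁺ˡ (subst (_∈ _) (bumpFrom-< c<a)
                          (∈-map⁺ (bumpFrom a) (from (values c) (1≤c , ≤-pred (<-≤-trans c<a a≤1+m)))))
  occurs (_ , s≤s d≤m) | tri> _ _ (s≤s a≤d) =
    ∈-++⁺ˡ (subst (_∈ _) (bumpFrom-≥ a≤d)
      (∈-map⁺ (bumpFrom a) (from (values _) (≤-trans 1≤a a≤d , d≤m))))

maxL-≤ : ∀ x {m} → (∀ {c} → c ∈ x → c ≤ m) → maxL x ≤ m
maxL-≤ []      _       = z≤n
maxL-≤ (c ∷ x) bounded = ⊔-lub (bounded (here refl)) (maxL-≤ x (bounded ∘ there))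

valuesAre1To⇒isCayley : ∀ {x m} → ValuesAre1To x m → IsCayley x
valuesAre1To⇒isCayley {x} values =
  (λ {c} c∈x → proj₁ (to (values c) c∈x)) ,
  (λ k 1≤k k≤max → from (values k) (1≤k , ≤-trans k≤max (maxL-≤ x (λ {c} c∈x → proj₂ (to (values c) c∈x)))))

FirstOccurrence : List ℕ → ℕ → Set
FirstOccurrence x i = ∀ k → k < i → x ! k ≢ x ! i

AscentIffFirstOccurrence : List ℕ → Set
AscentIffFirstOccurrence x =
  ∀ i j → i ≡ suc j → i < length x → FirstOccurrence x i ⇔ x ! j < x ! i

RelabelsPrefix : (ℕ → ℕ) → List ℕ → List ℕ → Set
RelabelsPrefix g v x = ∀ k → k < length v → x ! k ≡ g (v ! k)

relabelsPrefix-++ : ∀ v w → RelabelsPrefix (λ c → c) v (v ++ w)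
relabelsPrefix-++ v w k k<v = !-++ˡ v w k<v

relabelsPrefix-map-++ : ∀ g v w → RelabelsPrefix g v (map g v ++ w)
relabelsPrefix-map-++ g v w k k<v =
  trans (!-++ˡ (map g v) w (subst (k <_) (sym (length-map g v)) k<v)) (!-map g v k<v)

module _ {g : ℕ → ℕ} (v x : List ℕ) (rel : RelabelsPrefix g v x) where

  firstOccurrence-relabel : (∀ {p q} → g p ≡ g q → p ≡ q) → ∀ {i} → i < length v →
                            FirstOccurrence x i ⇔ FirstOccurrence v i
  firstOccurrence-relabel g-inj {i} i<v = mk⇔
    (λ first k k<i vk≡vi → first k k<i
       (trans (rel k (<-trans k<i i<v)) (trans (cong g vk≡vi) (sym (rel i i<v)))))
    (λ first k k<i xk≡xi → first k k<i
       (g-inj (trans (sym (rel k (<-trans k<i i<v))) (trans xk≡xi (rel i i<v)))))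

  <-relabel : g Preserves _<_ ⟶ _<_ → ∀ {j i} → j < length v → i < length v →
              v ! j < v ! i ⇔ x ! j < x ! i
  <-relabel g-mono {j} {i} j<v i<v rewrite rel j j<v | rel i i<v =
    mk⇔ g-mono (strictMono-reflects-< g-mono)

  ascentIffFirstOccurrence-extend :
    ∀ {b} → g Preserves _<_ ⟶ _<_ → length x ≡ suc (length v) → last v ≡ just b →
    AscentIffFirstOccurrence v → (FirstOccurrence x (length v) ⇔ g b < x ! length v) →
    AscentIffFirstOccurrence x
  ascentIffFirstOccurrence-extend {b} g-mono len lastv ascents new i j i≡1+j i<x
    with m<1+n⇒m<n∨m≡n (subst (i <_) len i<x)
  ... | inj₁ i<v =
    ⇔-trans (firstOccurrence-relabel (strictMono-injective g-mono) i<v)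
      (⇔-trans (ascents i j i≡1+j i<v)
        (<-relabel g-mono (<-trans (subst (j <_) (sym i≡1+j) (n<1+n j)) i<v) i<v))
  ... | inj₂ refl = subst (λ c → FirstOccurrence x (length v) ⇔ c < x ! length v) (sym xj≡gb) new
    where
    1+j≡v : suc j ≡ length v
    1+j≡v = sym i≡1+j
    xj≡gb : x ! j ≡ g b
    xj≡gb = trans (rel j (subst (j <_) 1+j≡v (n<1+n j))) (cong g (!-last v lastv 1+j≡v))

Invariant : List ℕ → Set
Invariant x = ValuesAre1To x (suc (asc x)) × AscentIffFirstOccurrence x

invariant-weak : ∀ {v b a} → Invariant v → last v ≡ just b → 1 ≤ a → a ≤ b →
                 Invariant (v ++ [ a ])
invariant-weak {v} {b} {a} (values , ascents) lastv 1≤a a≤b =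
  subst (λ n → ValuesAre1To (v ++ [ a ]) (suc n)) (sym asc-same) (valuesAre1To-∷ʳ values 1≤a a≤max) ,
  ascentIffFirstOccurrence-extend v (v ++ [ a ]) (relabelsPrefix-++ v [ a ]) (λ c<d → c<d) (length-∷ʳ v a) lastv
    ascents (mk⇔ (⊥-elim ∘ notFirst) (⊥-elim ∘ notAscent))
  where
  a≤max : a ≤ suc (asc v)
  a≤max = ≤-trans a≤b (proj₂ (to (values b) (last-∈ v lastv)))
  asc-same : asc (v ++ [ a ]) ≡ asc v
  asc-same = trans (asc-∷ʳ v a lastv) (trans (cong (asc v +_) (ascStep-≥ a≤b)) (+-identityʳ _))
  notFirst : ¬ FirstOccurrence (v ++ [ a ]) (length v)
  notFirst first with ∈⇒index (from (values a) (1≤a , a≤max))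
  ... | k , k<v , vk≡a =
    first k k<v (trans (!-++ˡ v [ a ] k<v) (trans vk≡a (sym (!-∷ʳ-length v a))))
  notAscent : ¬ b < (v ++ [ a ]) ! length v
  notAscent b<a = <⇒≱ (subst (b <_) (!-∷ʳ-length v a) b<a) a≤b

invariant-asc : ∀ {v b a} → Invariant v → last v ≡ just b → b < a → a ≤ 2 + asc v →
                Invariant (map (bumpFrom a) v ++ [ a ])
invariant-asc {v} {b} {a} (values , ascents) lastv b<a a≤2+asc =
  subst (λ n → ValuesAre1To (w ++ [ a ]) (suc n)) (sym asc-succ) (valuesAre1To-bump values 1≤a a≤2+asc) ,
  ascentIffFirstOccurrence-extend v (w ++ [ a ]) (relabelsPrefix-map-++ (bumpFrom a) v [ a ]) (bumpFrom-strictMono a)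
    (trans (length-∷ʳ w a) (cong suc (length-map _ v))) lastv ascents (mk⇔ (λ _ → ascent) (λ _ → first))
  where
  w : List ℕ
  w = map (bumpFrom a) v
  1≤a : 1 ≤ a
  1≤a = ≤-trans (proj₁ (to (values b) (last-∈ v lastv))) (<⇒≤ b<a)
  lastw : last w ≡ just (bumpFrom a b)
  lastw = trans (last-map (bumpFrom a) v) (cong (Maybe.map (bumpFrom a)) lastv)
  asc-succ : asc (w ++ [ a ]) ≡ suc (asc v)
  asc-succ = begin
    asc (w ++ [ a ])                     ≡⟨ asc-∷ʳ w a lastw ⟩
    asc w + ascStep (bumpFrom a b) a     ≡⟨ cong₂ _+_ (asc-map (bumpFrom-strictMono a) v)
                                                      (cong (λ c → ascStep c a) (bumpFrom-< b<a)) ⟩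
    asc v + ascStep b a                  ≡⟨ cong (asc v +_) (ascStep-< b<a) ⟩
    asc v + 1                            ≡⟨ +-comm (asc v) 1 ⟩
    suc (asc v)                          ∎
  new≡a : (w ++ [ a ]) ! length v ≡ a
  new≡a = subst (λ n → (w ++ [ a ]) ! n ≡ a) (length-map _ v) (!-∷ʳ-length w a)
  ascent : bumpFrom a b < (w ++ [ a ]) ! length v
  ascent rewrite bumpFrom-< b<a | new≡a = b<a
  first : FirstOccurrence (w ++ [ a ]) (length v)
  first k k<v xk≡a = bumpFrom-≢ a (v ! k)
    (trans (sym (relabelsPrefix-map-++ (bumpFrom a) v [ a ] k k<v)) (trans xk≡a new≡a))

masInvariant : ∀ {x b} → MAS x → last x ≡ just b → Invariant x
masInvariant mas-empty ()
masInvariant mas-one _ =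
  (λ c → mk⇔ (λ { (here refl) → ≤-refl , ≤-refl }) (λ (1≤c , c≤1) → here (≤-antisym c≤1 1≤c))) ,
  (λ { _ _ refl (s≤s ()) })
masInvariant (mas-weak mas lastv 1≤a a≤b) _ = invariant-weak (masInvariant mas lastv) lastv 1≤a a≤b
masInvariant (mas-asc {v} {a = a} mas lastv b<a a≤2+asc) _ rewrite bump≡map-bumpFrom a v =
  invariant-asc (masInvariant mas lastv) lastv b<a a≤2+asc

isLeftmost⇔firstOccurrence : ∀ x i → IsLeftmost x i ⇔ FirstOccurrence x (toℕ i)
isLeftmost⇔firstOccurrence x i = mk⇔ toFirst fromFirst
  where
  toFirst : IsLeftmost x i → FirstOccurrence x (toℕ i)
  toFirst leftmost k k<i xk≡xi = leftmost j (subst (_< toℕ i) (sym j≡k) k<i) (begin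
      lookup x j   ≡⟨ lookup≡! x j ⟩
      x ! toℕ j    ≡⟨ cong (x !_) j≡k ⟩
      x ! k        ≡⟨ xk≡xi ⟩
      x ! toℕ i    ≡⟨ lookup≡! x i ⟨
      lookup x i   ∎)
    where
    j = fromℕ< (<-trans k<i (toℕ<n i))
    j≡k = toℕ-fromℕ< (<-trans k<i (toℕ<n i))
  fromFirst : FirstOccurrence x (toℕ i) → IsLeftmost x i
  fromFirst first j j<i lj≡li =
    first (toℕ j) j<i (trans (sym (lookup≡! x j)) (trans lj≡li (lookup≡! x i)))

mainTheorem10 : (n : ℕ) (x : List ℕ) → MAS x → length x ≡ n →
    ((i j : Fin (length x)) → toℕ i ≡ suc (toℕ j) → 1 < lookup x i →
       (IsLeftmost x i ⇔ (lookup x j < lookup x i)))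
    × IsCayley x
mainTheorem10 _ []      _   _ = (λ ()) , (λ ()) , λ { _ (s≤s z≤n) () }
mainTheorem10 _ (c ∷ x) mas _ = ascentIffLeftmost , valuesAre1To⇒isCayley (proj₁ invariant)
  where
  invariant = masInvariant mas (proj₂ (last-∷ c x))
  ascentIffLeftmost : (i j : Fin (length (c ∷ x))) → toℕ i ≡ suc (toℕ j) → 1 < lookup (c ∷ x) i →
                      IsLeftmost (c ∷ x) i ⇔ lookup (c ∷ x) j < lookup (c ∷ x) i
  ascentIffLeftmost i j i≡1+j _ =
    ⇔-trans (isLeftmost⇔firstOccurrence (c ∷ x) i)
      (subst₂ (λ p q → FirstOccurrence (c ∷ x) (toℕ i) ⇔ p < q)
        (sym (lookup≡! (c ∷ x) j)) (sym (lookup≡! (c ∷ x) i))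
        (proj₂ invariant (toℕ i) (toℕ j) i≡1+j (toℕ<n i)))
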